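{- Let $q$ be a prime power. Every multiset of size $nq$ in $\mathrm{AG}(2,q)$ having fewer than 3 special directions is a union of $n$ (not necessarily distinct) lines taken from at most 2 different parallel classes.
   Context: Points of $\mathrm{AG}(2,q)$ are vectors in $\mathbb F_q^2$; lines with slope $d\in\mathbb F_q$ are $Y=dX+b$, with slope $\infty$ are $X+b=0$; a parallel class is the set of lines of a given slope. Sizes and intersections of multisets count multiplicities. A direction $(d)$ is special for $M$ if not every line of slope $d$ contains $\lfloor|M|/q\rfloor$ or $\lceil|M|/q\rceil$ points of $M$. A union of lines is the multiset where each point's multiplicity is the number of lines (with repetition) containing it. -}

module Defs where

open import Level using (0ℓ)
open import Data.Nat using (ℕ; zero; suc; _+_; _∸_; _/_; NonZero; _^_)
open import Data.Nat.Primality using (Prime)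
open import Data.Fin using (Fin)
open import Data.List using (List; []; _∷_; map; allFin; concatMap)
open import Data.Nat.ListAction using (sum)
open import Data.Product using (Σ; _×_; _,_; proj₁; proj₂; ∃)
open import Data.Sum using (_⊎_)
open import Data.Empty using (⊥)
open import Relation.Nullary using (¬_; Dec; yes; no)
open import Relation.Binary.Definitions using (DecidableEquality)
open import Relation.Binary.PropositionalEquality using (_≡_; refl)
open import Algebra.Structures using (IsCommutativeRing)
open import Function.Bundles using (_↔_; Inverse)

IsPrimePower : ℕ → Set
IsPrimePower q = Σ ℕ λ p → Σ ℕ λ k → Prime p × q ≡ p ^ suc k

record FiniteField (q : ℕ) : Set₁ where
  infixl 6 _+F_
  infixl 7 _*F_
  field
    Carrier : Set
    _+F_ _*F_ : Carrier → Carrier → Carrier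
    -F_ : Carrier → Carrier
    0F 1F : Carrier
    isCommutativeRing : IsCommutativeRing _≡_ _+F_ _*F_ -F_ 0F 1F
    0≢1 : ¬ (0F ≡ 1F)
    inverse : ∀ x → ¬ (x ≡ 0F) → Σ Carrier λ y → x *F y ≡ 1F
    _≟F_ : DecidableEquality Carrier
    enumeration : Fin q ↔ Carrier

nonZero-helper : (q : ℕ) → Fin q → NonZero q
nonZero-helper (suc _) _ = _

module AG2 {q : ℕ} (F : FiniteField q) where
  open FiniteField F

  -- q ≠ 0 (there is an element 0F, hence Fin q is inhabited)
  q-nonZero : NonZero q
  q-nonZero = nonZero-helper q (Inverse.from enumeration 0F)

  elements : List Carrier
  elements = map (Inverse.to enumeration) (allFin q)

  Point : Set
  Point = Carrier × Carrier

  points : List Point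
  points = concatMap (λ x → map (λ y → (x , y)) elements) elements

  data Slope : Set where
    fin : Carrier → Slope
    ∞   : Slope

  -- a line: slope together with the parameter b
  --   (fin d , b) is  Y = dX + b ;   (∞ , b) is  X + b = 0
  Line : Set
  Line = Slope × Carrier

  slope : Line → Slope
  slope = proj₁

  _∈L_ : Point → Line → Set
  (x , y) ∈L (fin d , b) = y ≡ d *F x +F b
  (x , y) ∈L (∞ , b)     = x +F b ≡ 0F

  _∈L?_ : (p : Point) → (l : Line) → Dec (p ∈L l)
  (x , y) ∈L? (fin d , b) = y ≟F (d *F x +F b)
  (x , y) ∈L? (∞ , b)     = (x +F b) ≟F 0F

  Multiset : Set
  Multiset = Point → ℕ

  size : Multiset → ℕ
  size M = sum (map M points)

  lineCount : Multiset → Line → ℕ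
  lineCount M l = sum (map (λ p → restrict p (p ∈L? l)) points)
    where
    restrict : (p : Point) → Dec (p ∈L l) → ℕ
    restrict p (yes _) = M p
    restrict p (no _)  = 0

  ⌊_/q⌋ : ℕ → ℕ
  ⌊ m /q⌋ = _/_ m q {{q-nonZero}}

  ⌈_/q⌉ : ℕ → ℕ
  ⌈ m /q⌉ = _/_ (m + q ∸ 1) q {{q-nonZero}}

  Special : Multiset → Slope → Set
  Special M s = Σ Carrier λ b →
    ¬ (lineCount M (s , b) ≡ ⌊ size M /q⌋) × ¬ (lineCount M (s , b) ≡ ⌈ size M /q⌉)

  FewerThan3Special : Multiset → Set
  FewerThan3Special M =
    ¬ (Σ Slope λ s₁ → Σ Slope λ s₂ → Σ Slope λ s₃ →
         ¬ (s₁ ≡ s₂) × ¬ (s₁ ≡ s₃) × ¬ (s₂ ≡ s₃) ×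
         Special M s₁ × Special M s₂ × Special M s₃)

  unionOfLines : List Line → Multiset
  unionOfLines [] p = 0
  unionOfLines (l ∷ ls) p with p ∈L? l
  ... | yes _ = suc (unionOfLines ls p)
  ... | no _  = unionOfLines ls p

{-# OPTIONS --safe #-}
module Submission where

-- Through a point p pass q + 1 lines, one of each slope, and together they cover every
-- other point exactly once; so the numbers of points of M on them add up to |M| + q M(p).
-- If every slope other than s₁ and s₂ is non-special, each line of such a slope carries
-- exactly n points, which leaves  q M(p) + n = |M ∩ ℓ₁(p)| + |M ∩ ℓ₂(p)|,  where ℓᵢ(p) is
-- the line of slope sᵢ through p. Any two lines of slopes s₁ and s₂ meet in one point, so
-- comparing the four corners of a "rectangle" of such points gives M(p) = A(ℓ₁(p)) + B(ℓ₂(p)).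
-- That is, M is the union of A(ℓ) copies of each line ℓ of slope s₁ and B(ℓ) copies of each
-- line ℓ of slope s₂, and comparing sizes shows that there are n lines.

open import Defs
open import Data.Nat using (ℕ; _*_)
open import Data.List using (List; length)
open import Data.List.Relation.Unary.All using (All)
open import Data.Product using (Σ; _×_)
open import Data.Sum using (_⊎_)
open import Relation.Binary.PropositionalEquality using (_≡_)

open import Level using (0ℓ)
open import Function.Base using (_∘_; id)
open import Function.Bundles using (_↔_; Inverse)
open import Data.Empty using (⊥-elim)
open import Data.Nat using (zero; suc; _+_; _∸_; _/_; _≤_; _≟_; NonZero; z≤n; s≤s)
open import Data.Nat.Properties
open import Data.Nat.DivMod using (m*n/n≡m; +-distrib-/-∣ˡ; m<n⇒m/n≡0)
open import Data.Nat.Divisibility using (n∣m*n)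
open import Data.Nat.ListAction using (sum)
open import Data.Nat.ListAction.Properties using (sum-++)
open import Data.Nat.Tactic.RingSolver using (solve-∀)
open import Data.Fin using (Fin)
import Data.Fin as Fin
import Data.Fin.Properties as Finₚ
open import Data.List using ([]; _∷_; _++_; map; concatMap; replicate; allFin)
open import Data.List.Properties using (map-++; map-∘; map-tabulate; length-map; length-tabulate)
open import Data.List.Membership.Propositional using (_∈_; lose)
open import Data.List.Membership.Propositional.Properties using (∈-map⁺; ∈-allFin)
open import Data.List.Relation.Unary.Any as Any using (here; there)
import Data.List.Relation.Unary.All as All
open import Data.List.Relation.Unary.All.Properties using (++⁺; concat⁺; map⁺; replicate⁺)
open import Data.List.Extrema.Nat using (argmin; f[argmin]≤f[xs])
open import Data.Product using (_,_; proj₁; proj₂; ∃)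
open import Data.Product.Properties using (≡-dec)
open import Data.Sum using (inj₁; inj₂)
open import Relation.Nullary using (¬_; Dec; yes; no; ¬?; _×-dec_; contradiction)
open import Relation.Nullary.Decidable using (map′; decidable-stable)
open import Relation.Unary using (Decidable)
open import Relation.Binary.Definitions using (DecidableEquality)
open import Relation.Binary.PropositionalEquality
  using (_≢_; refl; sym; trans; cong; cong₂; subst; ≢-sym; module ≡-Reasoning)
open import Algebra.Bundles using (CommutativeRing)
import Algebra.Properties.AbelianGroup as AbelianGroupProperties
import Algebra.Properties.CommutativeSemigroup as CommutativeSemigroupProperties
import Algebra.Properties.Quasigroup as QuasigroupProperties
import Algebra.Properties.Ring as RingProperties

open ≡-Reasoning

private
  variable
    X Y : Set

∑ : List X → (X → ℕ) → ℕ
∑ xs f = sum (map f xs)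

∑-cong : ∀ (xs : List X) {f g : X → ℕ} → (∀ x → f x ≡ g x) → ∑ xs f ≡ ∑ xs g
∑-cong []       f≗g = refl
∑-cong (x ∷ xs) f≗g = cong₂ _+_ (f≗g x) (∑-cong xs f≗g)

∑-zero : ∀ (xs : List X) {f : X → ℕ} → (∀ x → f x ≡ 0) → ∑ xs f ≡ 0
∑-zero []       f≗0 = refl
∑-zero (x ∷ xs) f≗0 = cong₂ _+_ (f≗0 x) (∑-zero xs f≗0)

∑-const : ∀ (xs : List X) c → ∑ xs (λ _ → c) ≡ length xs * c
∑-const []       c = refl
∑-const (x ∷ xs) c = cong (c +_) (∑-const xs c)

∑-+ : ∀ (xs : List X) (f g : X → ℕ) → ∑ xs (λ x → f x + g x) ≡ ∑ xs f + ∑ xs g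
∑-+ []       f g = refl
∑-+ (x ∷ xs) f g = trans (cong (f x + g x +_) (∑-+ xs f g))
  (CommutativeSemigroupProperties.interchange +-commutativeSemigroup (f x) (g x) (∑ xs f) (∑ xs g))

∑-*ˡ : ∀ (xs : List X) c (f : X → ℕ) → ∑ xs (λ x → c * f x) ≡ c * ∑ xs f
∑-*ˡ []       c f = sym (*-zeroʳ c)
∑-*ˡ (x ∷ xs) c f = trans (cong (c * f x +_) (∑-*ˡ xs c f)) (sym (*-distribˡ-+ c (f x) (∑ xs f)))

∑-*ʳ : ∀ (xs : List X) (f : X → ℕ) c → ∑ xs (λ x → f x * c) ≡ ∑ xs f * c
∑-*ʳ []       f c = refl
∑-*ʳ (x ∷ xs) f c = trans (cong (f x * c +_) (∑-*ʳ xs f c)) (sym (*-distribʳ-+ c (f x) (∑ xs f)))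

∑-swap : ∀ (xs : List X) (ys : List Y) (f : X → Y → ℕ) →
  ∑ xs (λ x → ∑ ys (f x)) ≡ ∑ ys (λ y → ∑ xs (λ x → f x y))
∑-swap []       ys f = sym (∑-zero ys (λ _ → refl))
∑-swap (x ∷ xs) ys f = trans (cong (∑ ys (f x) +_) (∑-swap xs ys f)) (sym (∑-+ ys (f x) _))

∑-++ : ∀ (xs ys : List X) (f : X → ℕ) → ∑ (xs ++ ys) f ≡ ∑ xs f + ∑ ys f
∑-++ xs ys f = trans (cong sum (map-++ f xs ys)) (sum-++ (map f xs) (map f ys))

∑-map : ∀ (g : X → Y) (xs : List X) (f : Y → ℕ) → ∑ (map g xs) f ≡ ∑ xs (f ∘ g)
∑-map g xs f = cong sum (sym (map-∘ xs))

∑-concatMap : ∀ (g : X → List Y) (xs : List X) (f : Y → ℕ) →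
  ∑ (concatMap g xs) f ≡ ∑ xs (λ x → ∑ (g x) f)
∑-concatMap g []       f = refl
∑-concatMap g (x ∷ xs) f =
  trans (∑-++ (g x) (concatMap g xs) f) (cong (∑ (g x) f +_) (∑-concatMap g xs f))

∑-replicate : ∀ k (x : X) (f : X → ℕ) → ∑ (replicate k x) f ≡ k * f x
∑-replicate zero    x f = refl
∑-replicate (suc k) x f = cong (f x +_) (∑-replicate k x f)

∑-pairs : ∀ (xs : List X) (ys : List Y) (f : X × Y → ℕ) →
  ∑ (concatMap (λ x → map (λ y → (x , y)) ys) xs) f ≡ ∑ xs (λ x → ∑ ys (λ y → f (x , y)))
∑-pairs xs ys f = trans (∑-concatMap _ xs f) (∑-cong xs (λ x → ∑-map _ ys f))

∑-allFin-suc : ∀ n (f : Fin (suc n) → ℕ) → ∑ (allFin (suc n)) f ≡ f Fin.zero + ∑ (allFin n) (f ∘ Fin.suc)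
∑-allFin-suc n f = cong (f Fin.zero +_) (cong sum
  (trans (map-tabulate Fin.suc f) (sym (map-tabulate id (f ∘ Fin.suc)))))

-- xs lists every element exactly once, expressed through the sums it computes.
Enumerates : {X : Set} → List X → Set
Enumerates {X} xs = ∀ {f : X → ℕ} a → (∀ x → x ≢ a → f x ≡ 0) → ∑ xs f ≡ f a

allFin-enumerates : ∀ n → Enumerates (allFin n)
allFin-enumerates (suc n) {f} Fin.zero f≗0 = begin
  ∑ (allFin (suc n)) f                     ≡⟨ ∑-allFin-suc n f ⟩
  f Fin.zero + ∑ (allFin n) (f ∘ Fin.suc)  ≡⟨ cong (f Fin.zero +_) (∑-zero (allFin n) λ j → f≗0 (Fin.suc j) λ ()) ⟩
  f Fin.zero + 0                           ≡⟨ +-identityʳ _ ⟩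
  f Fin.zero                               ∎
allFin-enumerates (suc n) {f} (Fin.suc i) f≗0 = trans (∑-allFin-suc n f)
  (cong₂ _+_ (f≗0 Fin.zero λ ()) (allFin-enumerates n i (λ j j≢i → f≗0 (Fin.suc j) (j≢i ∘ Finₚ.suc-injective))))

map-enumerates : ∀ {xs : List Y} (e : Y ↔ X) → Enumerates xs → Enumerates (map (Inverse.to e) xs)
map-enumerates {xs = xs} e enum {f} a f≗0 = begin
  ∑ (map to xs) f    ≡⟨ ∑-map to xs f ⟩
  ∑ xs (f ∘ to)      ≡⟨ enum (from a) (λ x x≢ → f≗0 (to x) (x≢ ∘ to-injective)) ⟩
  f (to (from a))    ≡⟨ cong f (strictlyInverseˡ a) ⟩
  f a                ∎
  where
  open Inverse e
  to-injective : ∀ {x} → to x ≡ a → x ≡ from a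
  to-injective {x} to-x≡a = trans (sym (strictlyInverseʳ x)) (cong from to-x≡a)

pairs-enumerates : ∀ {xs : List X} {ys : List Y} → Enumerates xs → Enumerates ys →
  Enumerates (concatMap (λ x → map (λ y → (x , y)) ys) xs)
pairs-enumerates {xs = xs} {ys} enumˣ enumʸ {f} (a , b) f≗0 = begin
  ∑ (concatMap (λ x → map (λ y → (x , y)) ys) xs) f
    ≡⟨ ∑-pairs xs ys f ⟩
  ∑ xs (λ x → ∑ ys (λ y → f (x , y)))
    ≡⟨ enumˣ a (λ x x≢a → ∑-zero ys (λ y → f≗0 (x , y) (x≢a ∘ cong proj₁))) ⟩
  ∑ ys (λ y → f (a , y))
    ≡⟨ enumʸ b (λ y y≢b → f≗0 (a , y) (y≢b ∘ cong proj₂)) ⟩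
  f (a , b)
    ∎

𝟙 : {P : Set} → Dec P → ℕ
𝟙 (yes _) = 1
𝟙 (no _)  = 0

𝟙-yes : {P : Set} → P → (d : Dec P) → 𝟙 d ≡ 1
𝟙-yes p (yes _) = refl
𝟙-yes p (no ¬p) = contradiction p ¬p

𝟙-no : {P : Set} → ¬ P → (d : Dec P) → 𝟙 d ≡ 0
𝟙-no ¬p (yes p) = contradiction p ¬p
𝟙-no ¬p (no _)  = refl

module _ {X : Set} (_≟ˣ_ : DecidableEquality X) {xs : List X} (enum : Enumerates xs) where

  ∑-𝟙 : ∀ a (f : X → ℕ) → ∑ xs (λ x → 𝟙 (x ≟ˣ a) * f x) ≡ f a
  ∑-𝟙 a f = trans (enum a (λ x x≢a → cong (_* f x) (𝟙-no x≢a (x ≟ˣ a))))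
                  (trans (cong (_* f a) (𝟙-yes refl (a ≟ˣ a))) (*-identityˡ (f a)))

  ∑-exchange₂ : ∀ {f g : X → ℕ} {a b} → a ≢ b → (∀ x → x ≢ a → x ≢ b → f x ≡ g x) →
    ∑ xs f + (g a + g b) ≡ ∑ xs g + (f a + f b)
  ∑-exchange₂ {f} {g} {a} {b} a≢b f≗g = begin
    ∑ xs f + (g a + g b)                                       ≡⟨ sym (with-masses f (g a) (g b)) ⟩
    ∑ xs (λ x → f x + (𝟙 (x ≟ˣ a) * g a + 𝟙 (x ≟ˣ b) * g b))   ≡⟨ ∑-cong xs pointwise ⟩
    ∑ xs (λ x → g x + (𝟙 (x ≟ˣ a) * f a + 𝟙 (x ≟ˣ b) * f b))   ≡⟨ with-masses g (f a) (f b) ⟩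
    ∑ xs g + (f a + f b)                                       ∎
    where
    with-masses : ∀ h u v → ∑ xs (λ x → h x + (𝟙 (x ≟ˣ a) * u + 𝟙 (x ≟ˣ b) * v)) ≡ ∑ xs h + (u + v)
    with-masses h u v = trans (∑-+ xs h _) (cong (∑ xs h +_)
      (trans (∑-+ xs _ _) (cong₂ _+_ (∑-𝟙 a (λ _ → u)) (∑-𝟙 b (λ _ → v)))))
    swapˡ : ∀ u v → u + (1 * v + 0) ≡ v + (1 * u + 0)
    swapˡ = solve-∀
    swapʳ : ∀ u v → u + (0 + 1 * v) ≡ v + (0 + 1 * u)
    swapʳ = solve-∀
    pointwise : ∀ x → f x + (𝟙 (x ≟ˣ a) * g a + 𝟙 (x ≟ˣ b) * g b)
                    ≡ g x + (𝟙 (x ≟ˣ a) * f a + 𝟙 (x ≟ˣ b) * f b)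
    pointwise x with x ≟ˣ a | x ≟ˣ b
    ... | yes refl | yes refl = ⊥-elim (a≢b refl)
    ... | yes refl | no _     = swapˡ (f x) (g x)
    ... | no _     | yes refl = swapʳ (f x) (g x)
    ... | no x≢a   | no x≢b   = cong (_+ 0) (f≗g x x≢a x≢b)

∃? : ∀ {P : X → Set} {xs : List X} → (∀ x → x ∈ xs) → Decidable P → Dec (∃ P)
∃? complete P? = map′ Any.satisfied (λ (x , px) → lose (complete x) px) (Any.any? P? _)

⌈m*n/n⌉≡m : ∀ m n .{{_ : NonZero n}} → (m * n + n ∸ 1) / n ≡ m
⌈m*n/n⌉≡m m (suc n) = begin
  (m * suc n + suc n ∸ 1) / suc n  ≡⟨ cong (_/ suc n) (+-∸-assoc (m * suc n) (s≤s z≤n)) ⟩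
  (m * suc n + n) / suc n          ≡⟨ +-distrib-/-∣ˡ n (n∣m*n m) ⟩
  m * suc n / suc n + n / suc n    ≡⟨ cong₂ _+_ (m*n/n≡m m (suc n)) (m<n⇒m/n≡0 (n<1+n n)) ⟩
  m + 0                            ≡⟨ +-identityʳ m ⟩
  m                                ∎

rectangle : ∀ q .{{_ : NonZero q}} n (m : X → Y → ℕ) (u : X → ℕ) (v : Y → ℕ) →
  (∀ b c → q * m b c + n ≡ u b + v c) → ∀ b c b′ c′ → m b c + m b′ c′ ≡ m b c′ + m b′ c
rectangle q n m u v count b c b′ c′ = *-cancelˡ-≡ _ _ q (+-cancelʳ-≡ (n + n) _ _ (begin
    q * (m b c + m b′ c′) + (n + n)      ≡⟨ regroup q (m b c) (m b′ c′) n ⟩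
    (q * m b c + n) + (q * m b′ c′ + n)  ≡⟨ cong₂ _+_ (count b c) (count b′ c′) ⟩
    (u b + v c) + (u b′ + v c′)          ≡⟨ corners (u b) (u b′) (v c) (v c′) ⟩
    (u b + v c′) + (u b′ + v c)          ≡⟨ sym (cong₂ _+_ (count b c′) (count b′ c)) ⟩
    (q * m b c′ + n) + (q * m b′ c + n)  ≡⟨ sym (regroup q (m b c′) (m b′ c) n) ⟩
    q * (m b c′ + m b′ c) + (n + n)      ∎))
  where
  regroup : ∀ q x y n → q * (x + y) + (n + n) ≡ (q * x + n) + (q * y + n)
  regroup = solve-∀
  corners : ∀ a a′ c c′ → (a + c) + (a′ + c′) ≡ (a + c′) + (a′ + c)
  corners = solve-∀

-- Shifting A by its minimum along the column c₀ is what keeps both summands natural.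
separate : ∀ {X Y : Set} q .{{_ : NonZero q}} n {xs : List X} → (∀ x → x ∈ xs) → X → Y →
  (m : X → Y → ℕ) (u : X → ℕ) (v : Y → ℕ) → (∀ b c → q * m b c + n ≡ u b + v c) →
  Σ (X → ℕ) λ A → Σ (Y → ℕ) λ B → ∀ b c → m b c ≡ A b + B c
separate {X} {Y} q n {xs} complete b₁ c₀ m u v count = A , B , m≡A+B
  where
  b₀ : X
  b₀ = argmin (λ b → m b c₀) b₁ xs

  b₀-minimal : ∀ b → m b₀ c₀ ≤ m b c₀
  b₀-minimal b = All.lookup (f[argmin]≤f[xs] {f = λ b → m b c₀} b₁ xs) (complete b)

  A : X → ℕ
  A b = m b c₀ ∸ m b₀ c₀

  B : Y → ℕ
  B c = m b₀ c

  m≡A+B : ∀ b c → m b c ≡ A b + B c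
  m≡A+B b c = begin
    m b c                          ≡⟨ sym (m+n∸n≡m (m b c) (m b₀ c₀)) ⟩
    m b c + m b₀ c₀ ∸ m b₀ c₀      ≡⟨ cong (_∸ m b₀ c₀) (rectangle q n m u v count b c b₀ c₀) ⟩
    m b c₀ + m b₀ c ∸ m b₀ c₀      ≡⟨ +-∸-comm (m b₀ c) (b₀-minimal b) ⟩
    A b + B c                      ∎

module AffinePlane {q : ℕ} (F : FiniteField q) where
  open FiniteField F
  open AG2 F

  private
    instance
      q≢0 : NonZero q
      q≢0 = q-nonZero

    ring : CommutativeRing 0ℓ 0ℓ
    ring = record { isCommutativeRing = isCommutativeRing }

    module R = CommutativeRing ring
    module G = AbelianGroupProperties R.+-abelianGroup
    module Q = QuasigroupProperties G.quasigroup
    module CS = CommutativeSemigroupProperties R.+-commutativeSemigroup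
    module RP = RingProperties R.ring

  open R using () renaming (_-_ to infixl 6 _-F_)

  elements-enumerates : Enumerates elements
  elements-enumerates = map-enumerates {xs = allFin q} enumeration (allFin-enumerates q)

  elements-complete : ∀ x → x ∈ elements
  elements-complete x = subst (_∈ elements) (Inverse.strictlyInverseˡ enumeration x)
    (∈-map⁺ (Inverse.to enumeration) (∈-allFin _))

  length-elements : length elements ≡ q
  length-elements = trans (length-map _ (allFin q)) (length-tabulate id)

  ∑-elements-const : ∀ c → ∑ elements (λ _ → c) ≡ q * c
  ∑-elements-const c = trans (∑-const elements c) (cong (_* c) length-elements)

  points-enumerates : Enumerates points
  points-enumerates =
    pairs-enumerates {xs = elements} {ys = elements} elements-enumerates elements-enumerates

  slopes : List Slope
  slopes = ∞ ∷ map fin elements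

  fin-injective : ∀ {d e} → fin d ≡ fin e → d ≡ e
  fin-injective refl = refl

  slopes-enumerates : Enumerates slopes
  slopes-enumerates {f} ∞ f≗0 = begin
    f ∞ + ∑ (map fin elements) f  ≡⟨ cong (f ∞ +_) (∑-map fin elements f) ⟩
    f ∞ + ∑ elements (f ∘ fin)    ≡⟨ cong (f ∞ +_) (∑-zero elements (λ d → f≗0 (fin d) λ ())) ⟩
    f ∞ + 0                       ≡⟨ +-identityʳ (f ∞) ⟩
    f ∞                           ∎
  slopes-enumerates {f} (fin d) f≗0 = cong₂ _+_ (f≗0 ∞ λ ()) (trans (∑-map fin elements f)
    (elements-enumerates d (λ e e≢d → f≗0 (fin e) (e≢d ∘ fin-injective))))

  slopes-complete : ∀ s → s ∈ slopes
  slopes-complete ∞       = here refl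
  slopes-complete (fin d) = there (∈-map⁺ fin (elements-complete d))

  ∑-slopes-const : ∀ c → ∑ slopes (λ _ → c) ≡ suc q * c
  ∑-slopes-const c = cong (c +_) (trans (∑-map fin elements _) (∑-elements-const c))

  _≟S_ : DecidableEquality Slope
  fin d ≟S fin e = map′ (cong fin) fin-injective (d ≟F e)
  fin _ ≟S ∞     = no λ ()
  ∞     ≟S fin _ = no λ ()
  ∞     ≟S ∞     = yes refl

  _≟P_ : DecidableEquality Point
  _≟P_ = ≡-dec _≟F_ _≟F_

  anotherSlope : ∀ s → Σ Slope (s ≢_)
  anotherSlope ∞       = fin 0F , λ ()
  anotherSlope (fin _) = ∞ , λ ()

  private
    inv : ∀ u → u ≢ 0F → Carrier
    inv u u≢0 = proj₁ (inverse u u≢0)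

    ≡*⇒≡*inv : ∀ {u} (u≢0 : u ≢ 0F) {w d} → w ≡ d *F u → d ≡ w *F inv u u≢0
    ≡*⇒≡*inv {u} u≢0 {w} {d} w≡du = begin
      d                      ≡⟨ sym (R.*-identityʳ d) ⟩
      d *F 1F                ≡⟨ cong (d *F_) (sym (proj₂ (inverse u u≢0))) ⟩
      d *F (u *F inv u u≢0)  ≡⟨ sym (R.*-assoc d u _) ⟩
      d *F u *F inv u u≢0    ≡⟨ cong (_*F inv u u≢0) (sym w≡du) ⟩
      w *F inv u u≢0         ∎

    *inv*-cancel : ∀ {u} (u≢0 : u ≢ 0F) w → w *F inv u u≢0 *F u ≡ w
    *inv*-cancel {u} u≢0 w = begin
      w *F inv u u≢0 *F u    ≡⟨ R.*-assoc w _ u ⟩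
      w *F (inv u u≢0 *F u)  ≡⟨ cong (w *F_) (trans (R.*-comm _ u) (proj₂ (inverse u u≢0))) ⟩
      w *F 1F                ≡⟨ R.*-identityʳ w ⟩
      w                      ∎

    -≡-⇒-≡- : ∀ {a b c e} → a -F b ≡ c -F e → a -F c ≡ b -F e
    -≡-⇒-≡- {a} {b} {c} {e} eq = begin
      a -F c              ≡⟨ cong (_-F c) (sym (G.//-rightDividesˡ b a)) ⟩
      a -F b +F b -F c    ≡⟨ cong (λ t → t +F b -F c) eq ⟩
      c -F e +F b -F c    ≡⟨ cong (_-F c) (R.+-comm (c -F e) b) ⟩
      b +F (c -F e) -F c  ≡⟨ R.+-assoc b (c -F e) (-F c) ⟩
      b +F (c -F e -F c)  ≡⟨ cong (b +F_) (G.xyx⁻¹≈y c (-F e)) ⟩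
      b -F e              ∎

  intercept : Slope → Point → Carrier
  intercept (fin d) (x , y) = y -F d *F x
  intercept ∞       (x , y) = -F x

  intercept-∈L : ∀ s p → p ∈L (s , intercept s p)
  intercept-∈L (fin d) (x , y) =
    sym (trans (R.+-comm (d *F x) (y -F d *F x)) (G.//-rightDividesˡ (d *F x) y))
  intercept-∈L ∞       (x , y) = R.-‿inverseʳ x

  ∈L⇒intercept : ∀ s {b} p → p ∈L (s , b) → intercept s p ≡ b
  ∈L⇒intercept (fin d) {b} (x , y) y≡dx+b =
    sym (Q.x≈z//y b (d *F x) y (trans (R.+-comm b (d *F x)) (sym y≡dx+b)))
  ∈L⇒intercept ∞       {b} (x , y) x+b≡0  = sym (G.inverseʳ-unique x b x+b≡0)

  intercept≡⇒∈L : ∀ s {b} p → intercept s p ≡ b → p ∈L (s , b)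
  intercept≡⇒∈L s p refl = intercept-∈L s p

  intercept-fin-≡ : ∀ d {x y x₀ y₀} →
    intercept (fin d) (x , y) ≡ intercept (fin d) (x₀ , y₀) → y -F y₀ ≡ d *F (x -F x₀)
  intercept-fin-≡ d {x} {x₀ = x₀} eq = trans (-≡-⇒-≡- eq) (sym (RP.x[y-z]≈xy-xz d x x₀))

  intercept-fin-≡⁻ : ∀ d {x y x₀ y₀} →
    y -F y₀ ≡ d *F (x -F x₀) → intercept (fin d) (x , y) ≡ intercept (fin d) (x₀ , y₀)
  intercept-fin-≡⁻ d {x} {x₀ = x₀} eq = -≡-⇒-≡- (trans eq (RP.x[y-z]≈xy-xz d x x₀))

  uniqueLine : ∀ {r p} → r ≢ p →
    Σ Slope λ s → intercept s r ≡ intercept s p × (∀ t → intercept t r ≡ intercept t p → t ≡ s)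
  uniqueLine {x , y} {x₀ , y₀} r≢p with x ≟F x₀
  ... | yes refl = ∞ , refl , vertical
    where
    vertical : ∀ t → intercept t (x , y) ≡ intercept t (x , y₀) → t ≡ ∞
    vertical ∞       _  = refl
    vertical (fin d) eq = ⊥-elim (r≢p (cong (x ,_) (Q.cancelʳ (-F (d *F x)) y y₀ eq)))
  ... | no x≢x₀ = fin d , intercept-fin-≡⁻ d (sym (*inv*-cancel u≢0 (y -F y₀))) , nonvertical
    where
    u≢0 : x -F x₀ ≢ 0F
    u≢0 = x≢x₀ ∘ G.x∙y⁻¹≈ε⇒x≈y x x₀
    d : Carrier
    d = (y -F y₀) *F inv (x -F x₀) u≢0
    nonvertical : ∀ t → intercept t (x , y) ≡ intercept t (x₀ , y₀) → t ≡ fin d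
    nonvertical ∞       eq = ⊥-elim (x≢x₀ (G.⁻¹-injective eq))
    nonvertical (fin e) eq = cong fin (≡*⇒≡*inv u≢0 (intercept-fin-≡ e eq))

  intersection : ∀ {s₁ s₂} → s₁ ≢ s₂ → ∀ b c → Σ Point λ r → intercept s₁ r ≡ b × intercept s₂ r ≡ c
  intersection {fin d₁} {fin d₂} d₁≢d₂ b c = (x , d₂ *F x +F c) , on₁ , G.xyx⁻¹≈y (d₂ *F x) c
    where
    u≢0 : d₂ -F d₁ ≢ 0F
    u≢0 = d₁≢d₂ ∘ cong fin ∘ sym ∘ G.x∙y⁻¹≈ε⇒x≈y d₂ d₁
    x : Carrier
    x = (b -F c) *F inv (d₂ -F d₁) u≢0
    on₁ : d₂ *F x +F c -F d₁ *F x ≡ b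
    on₁ = begin
      d₂ *F x +F c -F d₁ *F x    ≡⟨ CS.xy∙z≈xz∙y (d₂ *F x) c (-F (d₁ *F x)) ⟩
      d₂ *F x -F d₁ *F x +F c    ≡⟨ cong (_+F c) (sym (RP.[y-z]x≈yx-zx x d₂ d₁)) ⟩
      (d₂ -F d₁) *F x +F c       ≡⟨ cong (_+F c) (trans (R.*-comm _ x) (*inv*-cancel u≢0 (b -F c))) ⟩
      b -F c +F c                ≡⟨ G.//-rightDividesˡ c b ⟩
      b                          ∎
  intersection {fin d} {∞}     _   b c =
    (-F c , d *F (-F c) +F b) , G.xyx⁻¹≈y (d *F (-F c)) b , G.⁻¹-involutive c
  intersection {∞}     {fin d} _   b c =
    (-F b , d *F (-F b) +F c) , G.⁻¹-involutive b , G.xyx⁻¹≈y (d *F (-F b)) c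
  intersection {∞}     {∞}     ∞≢∞ = ⊥-elim (∞≢∞ refl)

  intersection-intercepts : ∀ {s₁ s₂} (s₁≢s₂ : s₁ ≢ s₂) p →
    proj₁ (intersection s₁≢s₂ (intercept s₁ p) (intercept s₂ p)) ≡ p
  intersection-intercepts {s₁} {s₂} s₁≢s₂ p =
    let (r , on₁ , on₂) = intersection s₁≢s₂ (intercept s₁ p) (intercept s₂ p) in
    decidable-stable (r ≟P p) λ r≢p →
      let (_ , _ , unique) = uniqueLine r≢p in
      s₁≢s₂ (trans (unique s₁ on₁) (sym (unique s₂ on₂)))

  incidence : Line → Point → ℕ
  incidence l p = 𝟙 (p ∈L? l)

  incidence-intercept : ∀ s p → incidence (s , intercept s p) p ≡ 1
  incidence-intercept s p = 𝟙-yes (intercept-∈L s p) (p ∈L? _)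

  incidence-off : ∀ s {b} p → b ≢ intercept s p → incidence (s , b) p ≡ 0
  incidence-off s p b≢ = 𝟙-no (λ p∈ → b≢ (sym (∈L⇒intercept s p p∈))) (p ∈L? _)

  line-size : ∀ l → ∑ points (incidence l) ≡ q
  line-size (fin d , b) = begin
    ∑ points (incidence (fin d , b))
      ≡⟨ ∑-pairs elements elements _ ⟩
    ∑ elements (λ x → ∑ elements (λ y → incidence (fin d , b) (x , y)))
      ≡⟨ ∑-cong elements on-column ⟩
    ∑ elements (λ _ → 1)
      ≡⟨ ∑-elements-const 1 ⟩
    q * 1
      ≡⟨ *-identityʳ q ⟩
    q
      ∎
    where
    on-column : ∀ x → ∑ elements (λ y → incidence (fin d , b) (x , y)) ≡ 1
    on-column x = trans (elements-enumerates (d *F x +F b) (λ y y≢ → 𝟙-no y≢ (y ≟F _))) (𝟙-yes refl _)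
  line-size (∞ , b) = begin
    ∑ points (incidence (∞ , b))
      ≡⟨ ∑-pairs elements elements _ ⟩
    ∑ elements (λ x → ∑ elements (λ y → incidence (∞ , b) (x , y)))
      ≡⟨ elements-enumerates (-F b) off-column ⟩
    ∑ elements (λ y → incidence (∞ , b) (-F b , y))
      ≡⟨ ∑-cong elements (λ y → 𝟙-yes (R.-‿inverseˡ b) _) ⟩
    ∑ elements (λ _ → 1)
      ≡⟨ ∑-elements-const 1 ⟩
    q * 1
      ≡⟨ *-identityʳ q ⟩
    q
      ∎
    where
    off-column : ∀ x → x ≢ -F b → ∑ elements (λ y → incidence (∞ , b) (x , y)) ≡ 0
    off-column x x≢ = ∑-zero elements (λ y → 𝟙-no (x≢ ∘ G.inverseˡ-unique x b) _)

  pencil-count : ∀ p r → ∑ slopes (λ s → incidence (s , intercept s p) r) ≡ 1 + q * 𝟙 (r ≟P p)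
  pencil-count p r with r ≟P p
  ... | yes refl = trans (∑-cong slopes (λ s → incidence-intercept s r)) (∑-slopes-const 1)
  ... | no r≢p = let (s , s-joins , s-unique) = uniqueLine r≢p in begin
    ∑ slopes (λ t → incidence (t , intercept t p) r)
      ≡⟨ slopes-enumerates s (λ t t≢s → incidence-off t r (λ eq → t≢s (s-unique t (sym eq)))) ⟩
    incidence (s , intercept s p) r  ≡⟨ 𝟙-yes (intercept≡⇒∈L s r s-joins) _ ⟩
    1                                ≡⟨ cong suc (sym (*-zeroʳ q)) ⟩
    1 + q * 0                        ∎

  -- The summand of lineCount is local to its definition; unification recovers it.
  lineCount-summand : Multiset → Line → Point → ℕ
  lineCount-summand M l = summand (refl {x = lineCount M l})
    where
    summand : {f : Point → ℕ} {m : ℕ} → ∑ points f ≡ m → Point → ℕ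
    summand {f} _ = f

  lineCount-summand≡ : ∀ M l p → lineCount-summand M l p ≡ incidence l p * M p
  lineCount-summand≡ M l p with p ∈L? l
  ... | yes _ = sym (+-identityʳ (M p))
  ... | no _  = refl

  lineCount≡∑ : ∀ M l → lineCount M l ≡ ∑ points (λ p → incidence l p * M p)
  lineCount≡∑ M l = ∑-cong points (lineCount-summand≡ M l)

  pencil : ∀ M p → ∑ slopes (λ s → lineCount M (s , intercept s p)) ≡ size M + q * M p
  pencil M p = begin
    ∑ slopes (λ s → lineCount M (s , intercept s p))
      ≡⟨ ∑-cong slopes (λ s → lineCount≡∑ M (s , intercept s p)) ⟩
    ∑ slopes (λ s → ∑ points (λ r → incidence (s , intercept s p) r * M r))
      ≡⟨ ∑-swap slopes points _ ⟩
    ∑ points (λ r → ∑ slopes (λ s → incidence (s , intercept s p) r * M r))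
      ≡⟨ ∑-cong points (λ r → ∑-*ʳ slopes (λ s → incidence (s , intercept s p) r) (M r)) ⟩
    ∑ points (λ r → ∑ slopes (λ s → incidence (s , intercept s p) r) * M r)
      ≡⟨ ∑-cong points (λ r → cong (_* M r) (pencil-count p r)) ⟩
    ∑ points (λ r → (1 + q * 𝟙 (r ≟P p)) * M r)
      ≡⟨ ∑-cong points (λ r → expand q (𝟙 (r ≟P p)) (M r)) ⟩
    ∑ points (λ r → M r + q * (𝟙 (r ≟P p) * M r))
      ≡⟨ ∑-+ points M _ ⟩
    size M + ∑ points (λ r → q * (𝟙 (r ≟P p) * M r))
      ≡⟨ cong (size M +_) (∑-*ˡ points q _) ⟩
    size M + q * ∑ points (λ r → 𝟙 (r ≟P p) * M r)
      ≡⟨ cong (λ t → size M + q * t) (∑-𝟙 _≟P_ {xs = points} points-enumerates p M) ⟩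
    size M + q * M p
      ∎
    where
    expand : ∀ q δ m → (1 + q * δ) * m ≡ m + q * (δ * m)
    expand = solve-∀

  lineCount-nonSpecial : ∀ {M n s} → size M ≡ n * q → ¬ Special M s → ∀ b → lineCount M (s , b) ≡ n
  lineCount-nonSpecial {M} {n} {s} size≡ ¬special b =
    decidable-stable (lineCount M (s , b) ≟ n) λ ≢n →
      ¬special (b , (λ eq → ≢n (trans eq ⌊⌋≡n)) , (λ eq → ≢n (trans eq ⌈⌉≡n)))
    where
    ⌊⌋≡n : ⌊ size M /q⌋ ≡ n
    ⌊⌋≡n = trans (cong ⌊_/q⌋ size≡) (m*n/n≡m n q)
    ⌈⌉≡n : ⌈ size M /q⌉ ≡ n
    ⌈⌉≡n = trans (cong ⌈_/q⌉ size≡) (⌈m*n/n⌉≡m n q)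

  special? : ∀ M → Decidable (Special M)
  special? M s = ∃? elements-complete λ b →
    ¬? (lineCount M (s , b) ≟ ⌊ size M /q⌋) ×-dec ¬? (lineCount M (s , b) ≟ ⌈ size M /q⌉)

  SpecialWithin : Multiset → Slope → Slope → Set
  SpecialWithin M s₁ s₂ = ∀ s → s ≢ s₁ → s ≢ s₂ → ¬ Special M s

  specialWithinPair : ∀ M → FewerThan3Special M →
    Σ Slope λ s₁ → Σ Slope λ s₂ → s₁ ≢ s₂ × SpecialWithin M s₁ s₂
  specialWithinPair M few with ∃? slopes-complete (special? M)
  ... | no none = ∞ , fin 0F , (λ ()) , λ s _ _ sp → none (s , sp)
  ... | yes (a , spa) with ∃? slopes-complete (λ s → ¬? (s ≟S a) ×-dec special? M s)
  ...   | no none = let (t , a≢t) = anotherSlope a in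
          a , t , a≢t , λ s s≢a _ sp → none (s , s≢a , sp)
  ...   | yes (b , b≢a , spb) with ∃? slopes-complete (λ s → ¬? (s ≟S a) ×-dec ¬? (s ≟S b) ×-dec special? M s)
  ...     | no none = a , b , ≢-sym b≢a , λ s s≢a s≢b sp → none (s , s≢a , s≢b , sp)
  ...     | yes (c , c≢a , c≢b , spc) =
          ⊥-elim (few (a , b , c , ≢-sym b≢a , ≢-sym c≢a , ≢-sym c≢b , spa , spb , spc))

  twoLineCount : ∀ {M n s₁ s₂} → size M ≡ n * q → s₁ ≢ s₂ → SpecialWithin M s₁ s₂ → ∀ p →
    q * M p + n ≡ lineCount M (s₁ , intercept s₁ p) + lineCount M (s₂ , intercept s₂ p)
  twoLineCount {M} {n} {s₁} {s₂} size≡ s₁≢s₂ within p = +-cancelʳ-≡ (n * q + n) _ _ (begin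
    (q * M p + n) + (n * q + n)          ≡⟨ regroup q (M p) n ⟩
    (n * q + q * M p) + (n + n)          ≡⟨ cong (_+ (n + n)) (sym ∑h≡) ⟩
    ∑ slopes h + (n + n)                 ≡⟨ ∑-exchange₂ _≟S_ {xs = slopes} slopes-enumerates s₁≢s₂ others ⟩
    ∑ slopes (λ _ → n) + (h s₁ + h s₂)   ≡⟨ cong (_+ (h s₁ + h s₂)) (∑-slopes-const n) ⟩
    suc q * n + (h s₁ + h s₂)            ≡⟨ regroup′ q n (h s₁ + h s₂) ⟩
    (h s₁ + h s₂) + (n * q + n)          ∎)
    where
    h : Slope → ℕ
    h s = lineCount M (s , intercept s p)
    ∑h≡ : ∑ slopes h ≡ n * q + q * M p
    ∑h≡ = trans (pencil M p) (cong (_+ q * M p) size≡)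
    others : ∀ s → s ≢ s₁ → s ≢ s₂ → h s ≡ n
    others s s≢s₁ s≢s₂ = lineCount-nonSpecial {M} {n} {s} size≡ (within s s≢s₁ s≢s₂) (intercept s p)
    regroup : ∀ q m n → (q * m + n) + (n * q + n) ≡ (n * q + q * m) + (n + n)
    regroup = solve-∀
    regroup′ : ∀ q n k → suc q * n + k ≡ k + (n * q + n)
    regroup′ = solve-∀

  separable : ∀ {M n s₁ s₂} → size M ≡ n * q → s₁ ≢ s₂ → SpecialWithin M s₁ s₂ →
    Σ (Carrier → ℕ) λ A → Σ (Carrier → ℕ) λ B → ∀ p → M p ≡ A (intercept s₁ p) + B (intercept s₂ p)
  separable {M} {n} {s₁} {s₂} size≡ s₁≢s₂ within =
    let (A , B , m≡A+B) = separate q n elements-complete 0F 0F m u v count in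
    A , B , λ p → trans (cong M (sym (intersection-intercepts s₁≢s₂ p)))
                        (m≡A+B (intercept s₁ p) (intercept s₂ p))
    where
    point : Carrier → Carrier → Point
    point b c = proj₁ (intersection s₁≢s₂ b c)
    m : Carrier → Carrier → ℕ
    m b c = M (point b c)
    u v : Carrier → ℕ
    u b = lineCount M (s₁ , b)
    v c = lineCount M (s₂ , c)
    count : ∀ b c → q * m b c + n ≡ u b + v c
    count b c = let (_ , on₁ , on₂) = intersection s₁≢s₂ b c in
      trans (twoLineCount {M} {n} size≡ s₁≢s₂ within (point b c)) (cong₂ (λ b′ c′ → u b′ + v c′) on₁ on₂)

  unionOfLines≡∑ : ∀ ls p → unionOfLines ls p ≡ ∑ ls (λ l → incidence l p)
  unionOfLines≡∑ []       p = refl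
  unionOfLines≡∑ (l ∷ ls) p with p ∈L? l
  ... | yes _ = cong suc (unionOfLines≡∑ ls p)
  ... | no _  = unionOfLines≡∑ ls p

  unionOfLines-++ : ∀ ls ms p → unionOfLines (ls ++ ms) p ≡ unionOfLines ls p + unionOfLines ms p
  unionOfLines-++ ls ms p = begin
    unionOfLines (ls ++ ms) p
      ≡⟨ unionOfLines≡∑ (ls ++ ms) p ⟩
    ∑ (ls ++ ms) (λ l → incidence l p)
      ≡⟨ ∑-++ ls ms _ ⟩
    ∑ ls (λ l → incidence l p) + ∑ ms (λ l → incidence l p)
      ≡⟨ sym (cong₂ _+_ (unionOfLines≡∑ ls p) (unionOfLines≡∑ ms p)) ⟩
    unionOfLines ls p + unionOfLines ms p
      ∎

  size-unionOfLines : ∀ ls → size (unionOfLines ls) ≡ length ls * q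
  size-unionOfLines ls = begin
    ∑ points (unionOfLines ls)                     ≡⟨ ∑-cong points (unionOfLines≡∑ ls) ⟩
    ∑ points (λ p → ∑ ls (λ l → incidence l p))    ≡⟨ ∑-swap points ls _ ⟩
    ∑ ls (λ l → ∑ points (incidence l))            ≡⟨ ∑-cong ls line-size ⟩
    ∑ ls (λ _ → q)                                 ≡⟨ ∑-const ls q ⟩
    length ls * q                                  ∎

  parallelLines : Slope → (Carrier → ℕ) → List Line
  parallelLines s k = concatMap (λ b → replicate (k b) (s , b)) elements

  parallelLines-slope : ∀ s k → All (λ l → slope l ≡ s) (parallelLines s k)
  parallelLines-slope s k = concat⁺ (map⁺ (All.universal (λ b → replicate⁺ (k b) refl) elements))

  unionOfLines-parallel : ∀ s k p → unionOfLines (parallelLines s k) p ≡ k (intercept s p)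
  unionOfLines-parallel s k p = begin
    unionOfLines (parallelLines s k) p
      ≡⟨ unionOfLines≡∑ (parallelLines s k) p ⟩
    ∑ (parallelLines s k) (λ l → incidence l p)
      ≡⟨ ∑-concatMap _ elements _ ⟩
    ∑ elements (λ b → ∑ (replicate (k b) (s , b)) (λ l → incidence l p))
      ≡⟨ ∑-cong elements (λ b → ∑-replicate (k b) (s , b) _) ⟩
    ∑ elements (λ b → k b * incidence (s , b) p)
      ≡⟨ elements-enumerates (intercept s p) off-line ⟩
    k (intercept s p) * incidence (s , intercept s p) p
      ≡⟨ cong (k (intercept s p) *_) (incidence-intercept s p) ⟩
    k (intercept s p) * 1
      ≡⟨ *-identityʳ _ ⟩
    k (intercept s p)
      ∎
    where
    off-line : ∀ b → b ≢ intercept s p → k b * incidence (s , b) p ≡ 0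
    off-line b b≢ = trans (cong (k b *_) (incidence-off s p b≢)) (*-zeroʳ (k b))

  unionOfTwoParallelClasses : ∀ {M n} → size M ≡ n * q → ∀ s₁ s₂ (A B : Carrier → ℕ) →
    (∀ p → M p ≡ A (intercept s₁ p) + B (intercept s₂ p)) →
    Σ (List Line) λ ls → length ls ≡ n ×
      (Σ Slope λ s → Σ Slope λ t → All (λ l → slope l ≡ s ⊎ slope l ≡ t) ls) ×
      ((p : Point) → M p ≡ unionOfLines ls p)
  unionOfTwoParallelClasses {M} {n} size≡ s₁ s₂ A B M≡A+B = ls , length≡n , (s₁ , s₂ , slopes-ok) , M≡union
    where
    ls : List Line
    ls = parallelLines s₁ A ++ parallelLines s₂ B

    M≡union : ∀ p → M p ≡ unionOfLines ls p
    M≡union p = trans (M≡A+B p) (sym (trans (unionOfLines-++ (parallelLines s₁ A) (parallelLines s₂ B) p)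
      (cong₂ _+_ (unionOfLines-parallel s₁ A p) (unionOfLines-parallel s₂ B p))))

    length≡n : length ls ≡ n
    length≡n = *-cancelʳ-≡ (length ls) n q
      (trans (sym (size-unionOfLines ls)) (trans (sym (∑-cong points M≡union)) size≡))

    slopes-ok : All (λ l → slope l ≡ s₁ ⊎ slope l ≡ s₂) ls
    slopes-ok = ++⁺ (All.map inj₁ (parallelLines-slope s₁ A)) (All.map inj₂ (parallelLines-slope s₂ B))

corollary3p5 : (q : ℕ) → IsPrimePower q → (F : FiniteField q) →
    let open AG2 F in
    (n : ℕ) (M : Multiset) → size M ≡ n * q → FewerThan3Special M →
    Σ (List Line) λ ls → length ls ≡ n ×
      (Σ Slope λ s → Σ Slope λ t → All (λ l → slope l ≡ s ⊎ slope l ≡ t) ls) ×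
      ((p : Point) → M p ≡ unionOfLines ls p)
corollary3p5 q _ F n M size≡ few =
  let open AffinePlane F
      (s₁ , s₂ , s₁≢s₂ , within) = specialWithinPair M few
      (A , B , M≡A+B) = separable {M} {n} size≡ s₁≢s₂ within
  in unionOfTwoParallelClasses size≡ s₁ s₂ A B M≡A+B
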